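{- Let $(t_n)$ be a subprime Fibonacci sequence and let $t_j=a$, $t_{j+1}=b$ be consecutive terms forming a node, i.e., $a,b$ are positive, odd and coprime, and $t_{j-1}$ (if $j\ge1$) is even. Suppose $b=a+2^{k-2}d$ where $k$ is an integer and $d$ is an odd integer with $d>-a/2^{k-2}$. Then for $i=1,\dots,k$, $$t_{j+i-1}=a+2^{k-i}J_{i-1}d,$$ the terms $t_j,\dots,t_{j+k-2}$ (there are $k-1\ge 2$ of them) are odd, and $t_{j+k-1}=a+J_{k-1}d$ is even. In other words, the run generated by the node $(a,b)$ has length $k$ and consists of these terms.
   Context: A subprime Fibonacci sequence is a sequence $(t_n)_{n\ge0}$ of positive integers with $t_0,t_1$ arbitrary and, for $s=t_n+t_{n+1}$: $t_{n+2}=s$ if $s$ is prime, $t_{n+2}=s/p$ if $s$ is composite, $p$ the smallest prime factor of $s$. The run generated by a node $(a,b)=(t_j,t_{j+1})$ is the block of consecutive terms starting at $t_j$ consisting of odd terms followed by the first even term. The Jacobsthal numbers are defined by $J_0=0$, $J_1=1$, $J_n=J_{n-1}+2J_{n-2}$ for $n\ge2$ (so $J_n=(2^n-(-1)^n)/3$). -}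

module Defs where

open import Data.Nat using (ℕ; zero; suc; _+_; _*_; _<_; _≤_)
open import Data.Nat.Divisibility using (_∣_)
open import Data.Nat.Primality using (Prime)
open import Data.Product using (_×_)
open import Relation.Nullary using (¬_)
open import Relation.Binary.PropositionalEquality using (_≡_)

SmallestPrimeFactor : ℕ → ℕ → Set
SmallestPrimeFactor p s = Prime p × p ∣ s × (∀ q → Prime q → q ∣ s → p ≤ q)

-- Since all terms are positive, s ≥ 2, so "not prime" = "composite".
IsSubprimeFib : (ℕ → ℕ) → Set
IsSubprimeFib t =
  (∀ n → 0 < t n) ×
  (∀ n → (Prime (t n + t (suc n)) → t (suc (suc n)) ≡ t n + t (suc n)) ×
         (¬ Prime (t n + t (suc n)) →
            ∀ p → SmallestPrimeFactor p (t n + t (suc n)) →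
            t (suc (suc n)) * p ≡ t n + t (suc n)))

J : ℕ → ℕ
J zero = 0
J (suc zero) = 1
J (suc (suc n)) = J (suc n) + 2 * J n

{-# OPTIONS --safe #-}
-- Write t_{j+n} = a + 2^e J_n d with n + e = k - 1.  By the Jacobsthal recurrence two
-- consecutive such terms, with exponents e + 2 and e + 1, add up to 2 (a + 2^e J_{n+2} d).
-- That sum is even and is not 2, because the two terms differ (J_{n+1} is odd, 2 J_n is
-- even, d ≠ 0), so the subprime rule halves it and the closed form propagates up to the
-- term with e = 0.  Terms with e ≥ 1 are odd like a; the last one, a + J_{k-1} d, is a sum
-- of two odd numbers.  Finally k ≥ 3, since otherwise b = a + d would be even.
module Submission where

open import Defs
open import Data.Nat using (ℕ; suc; _+_; _*_; _∸_; _^_; _≤_)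
open import Data.Nat.Divisibility using (_∣_)
open import Data.Nat.Coprimality using (Coprime)
open import Data.Integer using (ℤ; +_; -_; _<_) renaming (_+_ to _+ℤ_; _*_ to _*ℤ_)
open import Data.Integer.Divisibility renaming (_∣_ to _∣ℤ_)
open import Data.Product using (_×_)
open import Relation.Nullary using (¬_)
open import Relation.Binary.PropositionalEquality using (_≡_)

open import Algebra.Bundles using (AbelianGroup)
open import Data.Nat using (zero; z≤n; s≤s)
open import Data.Nat.Base using (nonTrivial⇒n>1; >-nonZero)
import Data.Nat.Divisibility as ℕ
import Data.Nat.Properties as ℕ
open import Data.Nat.Primality using (Prime; prime[2]; prime⇒nonTrivial; composite-≢; prime⇒¬composite; euclidsLemma)
import Data.Nat.Tactic.RingSolver as ℕ-Solver
import Data.Integer as ℤ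
import Data.Integer.DivMod as ℤ
import Data.Integer.Divisibility.Signed as Signed
import Data.Integer.Properties as ℤ
open import Data.Integer.Tactic.RingSolver using (solve-∀)
open import Data.Product using (_,_; proj₁; proj₂)
open import Data.Sum using (inj₁; inj₂)
open import Data.Empty using (⊥-elim)
open import Relation.Binary.PropositionalEquality
  using (_≢_; refl; sym; trans; cong; cong₂; subst; module ≡-Reasoning)

open import Algebra.Properties.Group (AbelianGroup.group ℤ.+-0-abelianGroup)
  using () renaming (∙-cancelˡ to +-cancelˡ-≡)

odd⇒≡1+[/2]*2 : ∀ x → ¬ (+ 2 ∣ℤ x) → x ≡ + 1 +ℤ (x ℤ./ + 2) *ℤ + 2
odd⇒≡1+[/2]*2 x x-odd with x ℤ.% + 2 | ℤ.n%d<d x (+ 2) | ℤ.a≡a%n+[a/n]*n x (+ 2)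
... | 0 | _ | x≡ = ⊥-elim (x-odd (Signed.∣⇒∣ᵤ (Signed.divides (x ℤ./ + 2)
                      (trans x≡ (ℤ.+-identityˡ ((x ℤ./ + 2) *ℤ + 2))))))
... | 1 | _ | x≡ = x≡
... | suc (suc _) | s≤s (s≤s ()) | _

odd+odd⇒even : ∀ x y → ¬ (+ 2 ∣ℤ x) → ¬ (+ 2 ∣ℤ y) → + 2 ∣ℤ x +ℤ y
odd+odd⇒even x y x-odd y-odd = Signed.∣⇒∣ᵤ (Signed.divides (+ 1 +ℤ p +ℤ q) (begin
    x +ℤ y                                  ≡⟨ cong₂ _+ℤ_ (odd⇒≡1+[/2]*2 x x-odd) (odd⇒≡1+[/2]*2 y y-odd) ⟩
    (+ 1 +ℤ p *ℤ + 2) +ℤ (+ 1 +ℤ q *ℤ + 2)  ≡⟨ regroup p q ⟩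
    (+ 1 +ℤ p +ℤ q) *ℤ + 2                  ∎))
  where
    open ≡-Reasoning
    p = x ℤ./ + 2
    q = y ℤ./ + 2
    regroup : ∀ p q → (+ 1 +ℤ p *ℤ + 2) +ℤ (+ 1 +ℤ q *ℤ + 2) ≡ (+ 1 +ℤ p +ℤ q) *ℤ + 2
    regroup = solve-∀

odd+even⇒odd : ∀ x y → ¬ (+ 2 ∣ℤ x) → + 2 ∣ℤ y → ¬ (+ 2 ∣ℤ x +ℤ y)
odd+even⇒odd x y x-odd 2∣y 2∣x+y =
  x-odd (Signed.∣⇒∣ᵤ (Signed.∣m+n∣n⇒∣m {+ 2} {x} {y} (Signed.∣ᵤ⇒∣ 2∣x+y) (Signed.∣ᵤ⇒∣ 2∣y)))

odd*odd⇒odd : ∀ x y → ¬ (+ 2 ∣ℤ x) → ¬ (+ 2 ∣ℤ y) → ¬ (+ 2 ∣ℤ x *ℤ y)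
odd*odd⇒odd x y x-odd y-odd 2∣xy
  with euclidsLemma ℤ.∣ x ∣ ℤ.∣ y ∣ prime[2] (subst (2 ∣_) (ℤ.abs-* x y) 2∣xy)
... | inj₁ 2∣x = x-odd 2∣x
... | inj₂ 2∣y = y-odd 2∣y

J-odd : ∀ n → ¬ (2 ∣ J (suc n))
J-odd zero 2∣1 with ℕ.∣1⇒≡1 2∣1
... | ()
J-odd (suc n) 2∣J =
  J-odd n (ℕ.∣m+n∣m⇒∣n (subst (2 ∣_) (ℕ.+-comm (J (suc n)) (2 * J n)) 2∣J) (ℕ.m∣m*n (J n)))

pow-J-recurrence : ∀ e n → 2 ^ suc (suc e) * J n + 2 ^ suc e * J (suc n) ≡ 2 * (2 ^ e * J (suc (suc n)))
pow-J-recurrence e n = recurrence (2 ^ e) (J n) (J (suc n))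
  where
    recurrence : ∀ P x y → 2 * (2 * P) * x + 2 * P * y ≡ 2 * (P * (y + 2 * x))
    recurrence = ℕ-Solver.solve-∀

pow-J-distinct : ∀ e n → 2 ^ suc (suc e) * J n ≢ 2 ^ suc e * J (suc n)
pow-J-distinct e n eq = J-odd n (ℕ.divides (J n) (sym (trans (ℕ.*-comm (J n) 2) 2*J≡J)))
  where
    2*J≡J : 2 * J n ≡ J (suc n)
    2*J≡J = ℕ.*-cancelˡ-≡ (2 * J n) (J (suc n)) (2 ^ suc e) {{ℕ.m^n≢0 2 (suc e)}}
              (trans (sym (ℕ.*-assoc (2 ^ suc e) 2 (J n)))
                (trans (cong (_* J n) (ℕ.*-comm (2 ^ suc e) 2)) eq))

+-*-affine-sum : ∀ (a d : ℤ) x y z → x + y ≡ 2 * z →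
                 (a +ℤ + x *ℤ d) +ℤ (a +ℤ + y *ℤ d) ≡ + 2 *ℤ (a +ℤ + z *ℤ d)
+-*-affine-sum a d x y z x+y≡2z = begin
    (a +ℤ + x *ℤ d) +ℤ (a +ℤ + y *ℤ d)  ≡⟨ collect a d (+ x) (+ y) ⟩
    + 2 *ℤ a +ℤ + (x + y) *ℤ d           ≡⟨ cong (λ w → + 2 *ℤ a +ℤ w *ℤ d) (trans (cong +_ x+y≡2z) (ℤ.pos-* 2 z)) ⟩
    + 2 *ℤ a +ℤ (+ 2 *ℤ + z) *ℤ d        ≡⟨ factor a d (+ z) ⟩
    + 2 *ℤ (a +ℤ + z *ℤ d)              ∎
  where
    open ≡-Reasoning
    collect : ∀ a d x y → (a +ℤ x *ℤ d) +ℤ (a +ℤ y *ℤ d) ≡ + 2 *ℤ a +ℤ (x +ℤ y) *ℤ d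
    collect = solve-∀
    factor : ∀ a d z → + 2 *ℤ a +ℤ (+ 2 *ℤ z) *ℤ d ≡ + 2 *ℤ (a +ℤ z *ℤ d)
    factor = solve-∀

+-*-affine-injective : ∀ (a d : ℤ) .{{_ : ℤ.NonZero d}} x y → a +ℤ + x *ℤ d ≡ a +ℤ + y *ℤ d → x ≡ y
+-*-affine-injective a d x y eq = ℤ.+-injective (ℤ.*-cancelʳ-≡ (+ x) (+ y) d (+-cancelˡ-≡ a _ _ eq))

sum≡2⇒≡ : ∀ x y → 1 ≤ x → 1 ≤ y → x + y ≡ 2 → x ≡ y
sum≡2⇒≡ 1 1 _ _ _ = refl
sum≡2⇒≡ 1 (suc (suc y)) _ _ ()
sum≡2⇒≡ (suc (suc x)) (suc y) _ _ eq with trans (sym (ℕ.+-suc x y)) (ℕ.suc-injective (ℕ.suc-injective eq))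
... | ()

subprimeFib-halves : ∀ {t} → IsSubprimeFib t → ∀ n →
                     2 ∣ t n + t (suc n) → t n ≢ t (suc n) → t (suc (suc n)) * 2 ≡ t n + t (suc n)
subprimeFib-halves {t} (positive , rule) n 2∣s tₙ≢tₙ₊₁ =
  proj₂ (rule n) s-not-prime 2 (prime[2] , 2∣s , λ q q-prime _ → nonTrivial⇒n>1 q {{prime⇒nonTrivial q-prime}})
  where
    s = t n + t (suc n)
    s-positive : 1 ≤ s
    s-positive = ℕ.<-≤-trans (positive n) (ℕ.m≤m+n (t n) (t (suc n)))
    s-not-prime : ¬ Prime s
    s-not-prime s-prime = prime⇒¬composite s-prime
      (composite-≢ 2 {{_}} {{>-nonZero s-positive}}
        (λ 2≡s → tₙ≢tₙ₊₁ (sum≡2⇒≡ (t n) (t (suc n)) (positive n) (positive (suc n)) (sym 2≡s))) 2∣s)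

runTerm : ℕ → ℤ → ℕ → ℕ → ℤ
runTerm a d e n = + a +ℤ + (2 ^ e * J n) *ℤ d

runTerm-sum : ∀ a d e n →
  runTerm a d (suc (suc e)) n +ℤ runTerm a d (suc e) (suc n) ≡ + 2 *ℤ runTerm a d e (suc (suc n))
runTerm-sum a d e n = +-*-affine-sum (+ a) d (2 ^ suc (suc e) * J n) (2 ^ suc e * J (suc n)) (2 ^ e * J (suc (suc n)))
  (pow-J-recurrence e n)

node-exponent-positive : ∀ {a b} e (d : ℤ) → ¬ (2 ∣ a) → ¬ (2 ∣ b) → ¬ (+ 2 ∣ℤ d) →
                         + b ≡ + a +ℤ + (2 ^ e) *ℤ d → 1 ≤ e
node-exponent-positive {a} zero d a-odd b-odd d-odd b≡ =
  ⊥-elim (b-odd (subst (+ 2 ∣ℤ_) (sym (trans b≡ (cong (+ a +ℤ_) (ℤ.*-identityˡ d))))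
                       (odd+odd⇒even (+ a) d a-odd d-odd)))
node-exponent-positive (suc _) _ _ _ _ _ = s≤s z≤n

module Run {t} (sf : IsSubprimeFib t) {j a b m} {d : ℤ} (d-odd : ¬ (+ 2 ∣ℤ d))
           (tj≡a : t j ≡ a) (tj+1≡b : t (suc j) ≡ b) (b≡ : + b ≡ + a +ℤ + (2 ^ m) *ℤ d) where

  instance
    d-nonZero : ℤ.NonZero d
    d-nonZero = ℤ.≢-nonZero {d} λ { refl → d-odd (ℕ._∣0 2) }

  step : ∀ e n → + t (j + n) ≡ runTerm a d (suc (suc e)) n → + t (j + suc n) ≡ runTerm a d (suc e) (suc n) →
         + t (j + suc (suc n)) ≡ runTerm a d e (suc (suc n))
  step e n tᵤ≡ tⱼ₊ₙ₊₁≡ = ℤ.*-cancelʳ-≡ _ _ (+ 2) (begin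
      + t (j + suc (suc n)) *ℤ + 2  ≡⟨ sym (ℤ.pos-* (t (j + suc (suc n))) 2) ⟩
      + (t (j + suc (suc n)) * 2)   ≡⟨ cong (λ i → + (t i * 2)) j+2+n≡ ⟩
      + (t (suc (suc u)) * 2)       ≡⟨ cong +_ (subprimeFib-halves sf u sum-even tᵤ≢tᵤ₊₁) ⟩
      + (t u + t (suc u))           ≡⟨ sum≡ ⟩
      + 2 *ℤ T                      ≡⟨ ℤ.*-comm (+ 2) T ⟩
      T *ℤ + 2                      ∎)
    where
      open ≡-Reasoning
      u = j + n
      T = runTerm a d e (suc (suc n))
      j+2+n≡ : j + suc (suc n) ≡ suc (suc u)
      j+2+n≡ = trans (ℕ.+-suc j (suc n)) (cong suc (ℕ.+-suc j n))
      tᵤ₊₁≡ : + t (suc u) ≡ runTerm a d (suc e) (suc n)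
      tᵤ₊₁≡ = trans (cong (λ i → + t i) (sym (ℕ.+-suc j n))) tⱼ₊ₙ₊₁≡
      sum≡ : + (t u + t (suc u)) ≡ + 2 *ℤ T
      sum≡ = trans (cong₂ _+ℤ_ tᵤ≡ tᵤ₊₁≡) (runTerm-sum a d e n)
      sum-even : 2 ∣ t u + t (suc u)
      sum-even = Signed.∣⇒∣ᵤ (Signed.divides T (trans sum≡ (ℤ.*-comm (+ 2) T)))
      tᵤ≢tᵤ₊₁ : t u ≢ t (suc u)
      tᵤ≢tᵤ₊₁ eq = pow-J-distinct e n
        (+-*-affine-injective (+ a) d _ _ (trans (sym tᵤ≡) (trans (cong +_ eq) tᵤ₊₁≡)))

  consecutive : ∀ n e → n + e ≡ m →
                (+ t (j + n) ≡ runTerm a d (suc e) n) × (+ t (j + suc n) ≡ runTerm a d e (suc n))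
  consecutive zero .m refl = first , second
    where
      open ≡-Reasoning
      first : + t (j + 0) ≡ runTerm a d (suc m) 0
      first = begin
        + t (j + 0)           ≡⟨ cong (λ i → + t i) (ℕ.+-identityʳ j) ⟩
        + t j                 ≡⟨ cong +_ tj≡a ⟩
        + a                   ≡⟨ sym (ℤ.+-identityʳ (+ a)) ⟩
        + a +ℤ + 0 *ℤ d       ≡⟨ cong (λ z → + a +ℤ + z *ℤ d) (sym (ℕ.*-zeroʳ (2 ^ suc m))) ⟩
        runTerm a d (suc m) 0 ∎
      second : + t (j + 1) ≡ runTerm a d m 1
      second = begin
        + t (j + 1)                ≡⟨ cong (λ i → + t i) (ℕ.+-comm j 1) ⟩
        + t (suc j)                ≡⟨ cong +_ tj+1≡b ⟩
        + b                        ≡⟨ b≡ ⟩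
        + a +ℤ + (2 ^ m) *ℤ d      ≡⟨ cong (λ z → + a +ℤ + z *ℤ d) (sym (ℕ.*-identityʳ (2 ^ m))) ⟩
        runTerm a d m 1            ∎
  consecutive (suc n) e n+e≡m with consecutive n (suc e) (trans (ℕ.+-suc n e) n+e≡m)
  ... | tⱼ₊ₙ≡ , tⱼ₊ₙ₊₁≡ = tⱼ₊ₙ₊₁≡ , step e n tⱼ₊ₙ≡ tⱼ₊ₙ₊₁≡

  closed-form : ∀ n e → n + e ≡ suc m → + t (j + n) ≡ runTerm a d e n
  closed-form zero .(suc m) refl = proj₁ (consecutive 0 m refl)
  closed-form (suc n) e n+e≡m = proj₂ (consecutive n e (ℕ.suc-injective n+e≡m))

  odd-terms : ¬ (2 ∣ a) → ∀ i → i ≤ m → ¬ (2 ∣ t (j + i))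
  odd-terms a-odd i i≤m = subst (λ z → ¬ (+ 2 ∣ℤ z)) (sym tⱼ₊ᵢ≡)
      (odd+even⇒odd (+ a) (+ (2 ^ suc e * J i) *ℤ d) a-odd
        (Signed.∣⇒∣ᵤ (Signed.∣m⇒∣m*n {+ 2} {+ (2 ^ suc e * J i)} d
          (Signed.∣ᵤ⇒∣ (ℕ.∣m⇒∣m*n (J i) (ℕ.m∣m*n (2 ^ e)))))))
    where
      e = m ∸ i
      tⱼ₊ᵢ≡ : + t (j + i) ≡ runTerm a d (suc e) i
      tⱼ₊ᵢ≡ = closed-form i (suc e) (trans (ℕ.+-suc i e) (cong suc (ℕ.m+[n∸m]≡n i≤m)))

  last-term : + t (j + suc m) ≡ + a +ℤ + J (suc m) *ℤ d
  last-term = trans (closed-form (suc m) 0 (ℕ.+-identityʳ (suc m)))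
                    (cong (λ z → + a +ℤ + z *ℤ d) (ℕ.*-identityˡ (J (suc m))))

  last-term-even : ¬ (2 ∣ a) → 2 ∣ t (j + suc m)
  last-term-even a-odd = subst (+ 2 ∣ℤ_) (sym last-term)
    (odd+odd⇒even (+ a) (+ J (suc m) *ℤ d) a-odd (odd*odd⇒odd (+ J (suc m)) d (J-odd m) d-odd))

theorem8 : (t : ℕ → ℕ) → IsSubprimeFib t →
    (j a b : ℕ) → t j ≡ a → t (suc j) ≡ b →
    ¬ (2 ∣ a) → ¬ (2 ∣ b) → Coprime a b →
    (∀ i → j ≡ suc i → 2 ∣ t i) →
    (k : ℕ) (d : ℤ) → ¬ (+ 2 ∣ℤ d) →
    (- (+ a)) < (+ (2 ^ (k ∸ 2))) *ℤ d →
    + b ≡ + a +ℤ (+ (2 ^ (k ∸ 2))) *ℤ d →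
    3 ≤ k
    × (∀ i → 1 ≤ i → i ≤ k →
         + t (j + i ∸ 1) ≡ + a +ℤ (+ (2 ^ (k ∸ i) * J (i ∸ 1))) *ℤ d)
    × (∀ i → i ≤ k ∸ 2 → ¬ (2 ∣ t (j + i)))
    × 2 ∣ t (j + k ∸ 1)
    × + t (j + k ∸ 1) ≡ + a +ℤ (+ J (k ∸ 1)) *ℤ d
theorem8 t sf j a b tj≡a tj+1≡b a-odd b-odd _ _ zero d d-odd _ b≡
  with () ← node-exponent-positive 0 d a-odd b-odd d-odd b≡
theorem8 t sf j a b tj≡a tj+1≡b a-odd b-odd _ _ (suc zero) d d-odd _ b≡
  with () ← node-exponent-positive 0 d a-odd b-odd d-odd b≡
theorem8 t sf j a b tj≡a tj+1≡b a-odd b-odd _ _ (suc (suc m)) d d-odd _ b≡ =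
  s≤s (s≤s (node-exponent-positive m d a-odd b-odd d-odd b≡)) ,
  run , odd-terms a-odd ,
  subst (λ i → 2 ∣ t (i ∸ 1)) (sym j+k≡) (last-term-even a-odd) ,
  subst (λ i → + t (i ∸ 1) ≡ + a +ℤ + J (suc m) *ℤ d) (sym j+k≡) last-term
  where
    open Run sf {m = m} {d = d} d-odd tj≡a tj+1≡b b≡
    j+k≡ : j + suc (suc m) ≡ suc (j + suc m)
    j+k≡ = ℕ.+-suc j (suc m)
    run : ∀ i → 1 ≤ i → i ≤ suc (suc m) →
          + t (j + i ∸ 1) ≡ + a +ℤ + (2 ^ (suc (suc m) ∸ i) * J (i ∸ 1)) *ℤ d
    run (suc n) _ (s≤s n≤1+m) = trans (cong (λ i → + t (i ∸ 1)) (ℕ.+-suc j n))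
                                      (closed-form n (suc m ∸ n) (ℕ.m+[n∸m]≡n n≤1+m))
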